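{- Let $k\le l$ be positive integers with $\gcd(k,l)=1$, let $n\ge1$, $m\ge0$ be integers, and write $m=qn+r$ with integers $q\ge 0$, $0\le r<n$. Let $A\in\mathcal D^{k,l}(m,n)$. Let $W$ be a submatrix of $A$ (given by a set $I$ of rows and a set $J$ of columns) all of whose entries are at most $q$, and whose sum of dimensions $|I|+|J|$ is the largest possible among such submatrices. Let $t_1=nk-|I|$ and $t_2=nl-|J|$ (so that the submatrix $X$ of $A$ formed by the rows not in $I$ and the columns not in $J$ has size $t_1\times t_2$). Then $$qt_1t_2+r(t_1l+t_2k)\ge klnr.$$
   Context: $\mathcal D^{k,l}(m,n)$ denotes the set of all $nk\times nl$ matrices with nonnegative integer entries all of whose row sums equal $ml$ and all of whose column sums equal $mk$. -}

module Defs where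

open import Data.Nat using (ℕ; zero; suc; _+_; _*_; _≤_)
open import Data.Fin using (Fin)
import Data.Fin
open import Data.Fin.Subset using (Subset; _∈_; ∣_∣)
open import Relation.Binary.PropositionalEquality using (_≡_)
open import Data.Product using (_×_)

∑ : ∀ {n} → (Fin n → ℕ) → ℕ
∑ {zero}  f = 0
∑ {suc n} f = f Data.Fin.zero + ∑ (λ i → f (Data.Fin.suc i))

Mat : ℕ → ℕ → Set
Mat a b = Fin a → Fin b → ℕ

InD : (k l m n : ℕ) → Mat (n * k) (n * l) → Set
InD k l m n A =
  ((i : Fin (n * k)) → ∑ (λ j → A i j) ≡ m * l) ×
  ((j : Fin (n * l)) → ∑ (λ i → A i j) ≡ m * k)

Bounded : ∀ {a b} → Mat a b → ℕ → Subset a → Subset b → Set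
Bounded A q I J = ∀ i j → i ∈ I → j ∈ J → A i j ≤ q

MaxBounded : ∀ {a b} → Mat a b → ℕ → Subset a → Subset b → Set
MaxBounded A q I J =
  Bounded A q I J ×
  (∀ I' J' → Bounded A q I' J' → ∣ I' ∣ + ∣ J' ∣ ≤ ∣ I ∣ + ∣ J ∣)

module Submission where

-- Count the total mass T of A in two ways.  Row-wise,
-- T = nk · ml.  On the other hand, split the rows into I and its
-- complement ∁I and, inside a row of I, the columns into J and ∁J:
--   * a row outside I contributes its full row sum ml;
--   * a row in I contributes at most |J|·q on J (entries of W are ≤ q)
--     plus its mass on ∁J, and the masses on ∁J of all rows together
--     add up to the column sums over ∁J, i.e. to |∁J| · mk.
-- Hence  nk · ml ≤ |I|·|J|·q + t₂·mk + t₁·ml  with t₁ = |∁I|, t₂ = |∁J|,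
-- and substituting |I| = nk − t₁, |J| = nl − t₂, m = qn + r this is,
-- after cancellation, exactly  klnr ≤ q t₁ t₂ + r (t₁ l + t₂ k).

open import Defs
open import Data.Nat using (ℕ; _+_; _*_; _∸_; _≤_; _<_; _≥_)
open import Data.Nat.GCD using (gcd)
open import Data.Fin.Subset using (Subset; ∣_∣)
open import Relation.Binary.PropositionalEquality using (_≡_)

open import Data.Nat using (zero; suc; z≤n)
open import Data.Nat.Properties
  using ( m+[n∸m]≡n; +-*-semiring; *-distribʳ-+; *-distribˡ-+; +-identityʳ
        ; +-mono-≤; +-monoˡ-≤; +-cancelˡ-≤; ≤-refl; ≤-reflexive; ≤-trans; module ≤-Reasoning)
import Data.Fin as F
open import Data.Fin.Subset using (_∈_; ∁)
open import Data.Fin.Subset.Properties using (∣p∣≤n; ∣∁p∣≡n∸∣p∣)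
open import Data.Bool using (Bool; true; false; not)
open import Data.Vec using (_∷_; []; lookup)
open import Data.Vec.Properties using (lookup-map; lookup⇒[]=)
open import Data.Vec.Functional using (Vector)
open import Data.Product using (_,_)
open import Relation.Binary.PropositionalEquality
  using (refl; sym; trans; cong; cong₂; subst₂; module ≡-Reasoning)
open import Algebra.Properties.Semiring.Sum +-*-semiring
  using (sum; sum-cong-≗; ∑-distrib-+; ∑-comm; *-distribˡ-sum; *-distribʳ-sum)
open import Data.Nat.Tactic.RingSolver using (solve-∀)

∑≡sum : ∀ {n} (f : Vector ℕ n) → ∑ f ≡ sum f
∑≡sum {zero}  f = refl
∑≡sum {suc n} f = cong (f F.zero +_) (∑≡sum (λ i → f (F.suc i)))

sum-mono : ∀ {n} {f g : Vector ℕ n} → (∀ i → f i ≤ g i) → sum f ≤ sum g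
sum-mono {zero}  f≤g = z≤n
sum-mono {suc n} f≤g = +-mono-≤ (f≤g F.zero) (sum-mono (λ i → f≤g (F.suc i)))

sum-const : ∀ n (c : ℕ) → sum {n} (λ _ → c) ≡ n * c
sum-const zero    c = refl
sum-const (suc n) c = cong (c +_) (sum-const n c)

indicator : Bool → ℕ
indicator true  = 1
indicator false = 0

χ : ∀ {n} → Subset n → Vector ℕ n
χ P i = indicator (lookup P i)

sumOver : ∀ {n} → Subset n → Vector ℕ n → ℕ
sumOver P f = sum (λ i → χ P i * f i)

χ-∁ : ∀ {n} (P : Subset n) i → χ P i + χ (∁ P) i ≡ 1
χ-∁ P i rewrite lookup-map i not P = complementary (lookup P i)
  where
  complementary : ∀ b → indicator b + indicator (not b) ≡ 1
  complementary true  = refl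
  complementary false = refl

sum-split : ∀ {n} (P : Subset n) (f : Vector ℕ n) →
  sum f ≡ sumOver P f + sumOver (∁ P) f
sum-split P f =
  trans (sum-cong-≗ pointwise) (∑-distrib-+ (λ i → χ P i * f i) (λ i → χ (∁ P) i * f i))
  where
  pointwise : ∀ i → f i ≡ χ P i * f i + χ (∁ P) i * f i
  pointwise i = begin
    f i                           ≡⟨ sym (+-identityʳ (f i)) ⟩
    1 * f i                       ≡⟨ cong (_* f i) (sym (χ-∁ P i)) ⟩
    (χ P i + χ (∁ P) i) * f i     ≡⟨ *-distribʳ-+ (f i) (χ P i) (χ (∁ P) i) ⟩
    χ P i * f i + χ (∁ P) i * f i ∎
    where open ≡-Reasoning

sum-χ : ∀ {n} (P : Subset n) → sum (χ P) ≡ ∣ P ∣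
sum-χ []          = refl
sum-χ (true ∷ P)  = cong suc (sum-χ P)
sum-χ (false ∷ P) = sum-χ P

sumOver-const : ∀ {n} (P : Subset n) {f : Vector ℕ n} c →
  (∀ i → f i ≡ c) → sumOver P f ≡ ∣ P ∣ * c
sumOver-const P {f} c f≡c = begin
  sum (λ i → χ P i * f i) ≡⟨ sum-cong-≗ (λ i → cong (χ P i *_) (f≡c i)) ⟩
  sum (λ i → χ P i * c)   ≡⟨ sym (*-distribʳ-sum c (χ P)) ⟩
  sum (χ P) * c           ≡⟨ cong (_* c) (sum-χ P) ⟩
  ∣ P ∣ * c               ∎
  where open ≡-Reasoning

χ-mono : ∀ {n} (P : Subset n) i {x y : ℕ} → (i ∈ P → x ≤ y) → χ P i * x ≤ χ P i * y
χ-mono P i {x} {y} x≤y with lookup P i in eq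
... | true  = subst₂ _≤_ (sym (+-identityʳ x)) (sym (+-identityʳ y)) (x≤y (lookup⇒[]= i P eq))
... | false = z≤n

χ-≤ : ∀ {n} (P : Subset n) i (x : ℕ) → χ P i * x ≤ x
χ-≤ P i x with lookup P i
... | true  = ≤-reflexive (+-identityʳ x)
... | false = z≤n

sumOver-∁-const : ∀ {n} (P : Subset n) {f : Vector ℕ n} c →
  (∀ i → f i ≡ c) → sumOver (∁ P) f ≡ (n ∸ ∣ P ∣) * c
sumOver-∁-const P c f≡c = trans (sumOver-const (∁ P) c f≡c) (cong (_* c) (∣∁p∣≡n∸∣p∣ P))

sumOver-bounded : ∀ {n} (P : Subset n) {f : Vector ℕ n} c →
  (∀ i → i ∈ P → f i ≤ c) → sumOver P f ≤ ∣ P ∣ * c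
sumOver-bounded P c f≤c = ≤-trans (sum-mono (λ i → χ-mono P i (f≤c i)))
  (≤-reflexive (sumOver-const P c (λ _ → refl)))

sumOver-rows : ∀ {a b} (A : Mat a b) (Q : Subset b) →
  sum (λ i → sumOver Q (A i)) ≡ sumOver Q (λ j → sum (λ i → A i j))
sumOver-rows A Q = begin
  sum (λ i → sum (λ j → χ Q j * A i j)) ≡⟨ ∑-comm (λ i j → χ Q j * A i j) ⟩
  sum (λ j → sum (λ i → χ Q j * A i j)) ≡⟨ sum-cong-≗ (λ j → sym (*-distribˡ-sum (χ Q j) (λ i → A i j))) ⟩
  sum (λ j → χ Q j * sum (λ i → A i j)) ∎
  where open ≡-Reasoning

-- If all entries of A on I × J are at most q, then the total
-- mass of A is at most |I|·|J|·q plus the column sums over ∁J plus the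
-- row sums over ∁I: a row of I has at most |J|·q on J, and the masses of
-- all rows on ∁J together form the column sums over ∁J.
massBound : ∀ {a b} (A : Mat a b) q (I : Subset a) (J : Subset b) → Bounded A q I J →
  sum (λ i → sum (A i))
    ≤ ∣ I ∣ * (∣ J ∣ * q) + sumOver (∁ J) (λ j → sum (λ i → A i j))
      + sumOver (∁ I) (λ i → sum (A i))
massBound A q I J bounded = begin
  sum R                                                 ≡⟨ sum-split I R ⟩
  sumOver I R + sumOver (∁ I) R                         ≤⟨ +-monoˡ-≤ (sumOver (∁ I) R) inI ⟩
  ∣ I ∣ * (∣ J ∣ * q) + sumOver (∁ J) C + sumOver (∁ I) R ∎
  where
  open ≤-Reasoning
  R : Vector ℕ _
  R i = sum (A i)
  C : Vector ℕ _
  C j = sum (λ i → A i j)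
  S : Vector ℕ _
  S i = sumOver (∁ J) (A i)

  rowBound : ∀ i → i ∈ I → R i ≤ ∣ J ∣ * q + S i
  rowBound i i∈I = begin
    R i                          ≡⟨ sum-split J (A i) ⟩
    sumOver J (A i) + S i        ≤⟨ +-monoˡ-≤ (S i) (sumOver-bounded J q (λ j → bounded i j i∈I)) ⟩
    ∣ J ∣ * q + S i              ∎

  weightedRow : ∀ i → χ I i * R i ≤ χ I i * (∣ J ∣ * q) + S i
  weightedRow i = begin
    χ I i * R i                          ≤⟨ χ-mono I i (rowBound i) ⟩
    χ I i * (∣ J ∣ * q + S i)            ≡⟨ *-distribˡ-+ (χ I i) (∣ J ∣ * q) (S i) ⟩
    χ I i * (∣ J ∣ * q) + χ I i * S i    ≤⟨ +-mono-≤ ≤-refl (χ-≤ I i (S i)) ⟩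
    χ I i * (∣ J ∣ * q) + S i            ∎

  inI : sumOver I R ≤ ∣ I ∣ * (∣ J ∣ * q) + sumOver (∁ J) C
  inI = begin
    sumOver I R                                         ≤⟨ sum-mono weightedRow ⟩
    sum (λ i → χ I i * (∣ J ∣ * q) + S i)               ≡⟨ ∑-distrib-+ (λ i → χ I i * (∣ J ∣ * q)) S ⟩
    sumOver I (λ _ → ∣ J ∣ * q) + sum S
      ≡⟨ cong₂ _+_ (sumOver-const I (∣ J ∣ * q) (λ _ → refl)) (sumOver-rows A (∁ J)) ⟩
    ∣ I ∣ * (∣ J ∣ * q) + sumOver (∁ J) C               ∎

-- Arithmetic core.  Writing X = nk = a + t₁ and Y = nl = b + t₂, the
-- term qXY = q(a + t₁)(b + t₂) occurs, expanded, on both sides of the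
-- counted inequality and cancels.
cancelCommon : ∀ q r k l a b t₁ t₂ X Y → a + t₁ ≡ X → b + t₂ ≡ Y →
  q * X * Y + r * (X * l) ≤ a * (b * q) + (q * t₂ * X + r * t₂ * k) + (q * t₁ * Y + r * t₁ * l) →
  r * (X * l) ≤ q * t₁ * t₂ + r * (t₁ * l + t₂ * k)
cancelCommon q r k l a b t₁ t₂ _ _ refl refl counted =
  +-cancelˡ-≤ common _ _
    (subst₂ _≤_ (expandLeft q r a b t₁ t₂ l) (expandRight q r a b t₁ t₂ k l) counted)
  where
  common : ℕ
  common = q * a * b + q * a * t₂ + q * t₁ * b + q * t₁ * t₂
  expandLeft : ∀ q r a b t₁ t₂ l → q * (a + t₁) * (b + t₂) + r * ((a + t₁) * l)
      ≡ (q * a * b + q * a * t₂ + q * t₁ * b + q * t₁ * t₂) + r * ((a + t₁) * l)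
  expandLeft = solve-∀
  expandRight : ∀ q r a b t₁ t₂ k l → a * (b * q) + (q * t₂ * (a + t₁) + r * t₂ * k) + (q * t₁ * (b + t₂) + r * t₁ * l)
      ≡ (q * a * b + q * a * t₂ + q * t₁ * b + q * t₁ * t₂) + (q * t₁ * t₂ + r * (t₁ * l + t₂ * k))
  expandRight = solve-∀

countedBound : ∀ q r k l n a b t₁ t₂ → a + t₁ ≡ n * k → b + t₂ ≡ n * l →
  n * k * ((q * n + r) * l) ≤ a * (b * q) + t₂ * ((q * n + r) * k) + t₁ * ((q * n + r) * l) →
  k * l * n * r ≤ q * t₁ * t₂ + r * (t₁ * l + t₂ * k)
countedBound q r k l n a b t₁ t₂ a+t₁ b+t₂ counted =
  subst₂ _≤_ (klnr n k l r) refl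
    (cancelCommon q r k l a b t₁ t₂ (n * k) (n * l) a+t₁ b+t₂
      (subst₂ _≤_ (total n k l q r) (masses n k l q r a b t₁ t₂) counted))
  where
  total : ∀ n k l q r → n * k * ((q * n + r) * l) ≡ q * (n * k) * (n * l) + r * (n * k * l)
  total = solve-∀
  masses : ∀ n k l q r a b t₁ t₂ → a * (b * q) + t₂ * ((q * n + r) * k) + t₁ * ((q * n + r) * l)
         ≡ a * (b * q) + (q * t₂ * (n * k) + r * t₂ * k) + (q * t₁ * (n * l) + r * t₁ * l)
  masses = solve-∀
  klnr : ∀ n k l r → r * (n * k * l) ≡ k * l * n * r
  klnr = solve-∀

mainTheorem7 : (k l n m q r : ℕ) → 1 ≤ k → k ≤ l → gcd k l ≡ 1 → 1 ≤ n →
    m ≡ q * n + r → r < n →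
    (A : Mat (n * k) (n * l)) → InD k l m n A →
    (I : Subset (n * k)) (J : Subset (n * l)) → MaxBounded A q I J →
    q * (n * k ∸ ∣ I ∣) * (n * l ∸ ∣ J ∣)
      + r * ((n * k ∸ ∣ I ∣) * l + (n * l ∸ ∣ J ∣) * k)
      ≥ k * l * n * r
mainTheorem7 k l n m q r _ _ _ _ refl _ A (rowSums , colSums) I J (bounded , _) =
  countedBound q r k l n ∣ I ∣ ∣ J ∣ (n * k ∸ ∣ I ∣) (n * l ∸ ∣ J ∣)
    (m+[n∸m]≡n (∣p∣≤n I)) (m+[n∸m]≡n (∣p∣≤n J)) counted
  where
  row : ∀ i → sum (A i) ≡ m * l
  row i = trans (sym (∑≡sum (A i))) (rowSums i)
  col : ∀ j → sum (λ i → A i j) ≡ m * k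
  col j = trans (sym (∑≡sum (λ i → A i j))) (colSums j)
  counted : n * k * (m * l) ≤ ∣ I ∣ * (∣ J ∣ * q) + (n * l ∸ ∣ J ∣) * (m * k) + (n * k ∸ ∣ I ∣) * (m * l)
  counted = subst₂ _≤_ (trans (sum-cong-≗ row) (sum-const (n * k) (m * l)))
    (cong₂ _+_ (cong (∣ I ∣ * (∣ J ∣ * q) +_) (sumOver-∁-const J (m * k) col))
               (sumOver-∁-const I (m * l) row))
    (massBound A q I J bounded)
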